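{- For every $n\ge 1$, there are at least $2^{2^n-1}$ $n$-cube unique sink orientations that have property L.
   Context: Notation: $[n]=\{1,\dots,n\}$; $\oplus$ is symmetric difference. An $n$-cube orientation is a directed graph with vertex set $2^{[n]}$ containing, for every $V\subseteq[n]$ and $i\in[n]$, exactly one of the edges $(V,V\oplus\{i\})$, $(V\oplus\{i\},V)$; its outmap is $\phi(V)=\{i: (V,V\oplus\{i\})\text{ is an edge}\}$. A face is the subgraph induced by an interval $\{X: A\subseteq X\subseteq B\}$ with $A\subseteq B\subseteq[n]$. It is a unique sink orientation (USO) if every face has exactly one sink (vertex with no outgoing edge in the face). The L-graph of $V$ has vertex set $[n]\setminus V$ and an arc $(i,j)$ for distinct $i,j\in[n]\setminus V$ whenever $j\in\phi(V)\oplus\phi(V\cup\{i\})$; property L means all L-graphs are acyclic. -}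

module Defs where

open import Data.Nat using (ℕ)
open import Data.Bool using (Bool; _xor_)
open import Data.Fin using (Fin)
open import Data.Fin.Subset using (Subset; _∈_; _∉_; _⊆_; _∪_; ⁅_⁆)
open import Data.Vec using (zipWith)
open import Data.Product using (Σ; _×_; ∃)
open import Data.Sum using (_⊎_)
open import Relation.Binary.PropositionalEquality using (_≡_; _≢_)
open import Relation.Nullary using (¬_)
open import Relation.Binary.Construct.Closure.Transitive using (TransClosure)

private variable n : ℕ

infixl 5 _⊕_
_⊕_ : Subset n → Subset n → Subset n
_⊕_ = zipWith _xor_

-- An n-cube orientation is represented by its outmap φ : 2^[n] → 2^[n]:
-- the edge (V , V ⊕ {i}) is present iff i ∈ φ V.
IsOrientation : (Subset n → Subset n) → Set
IsOrientation {n} φ = ∀ (V : Subset n) (i : Fin n) →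
  (i ∈ φ V × i ∉ φ (V ⊕ ⁅ i ⁆)) ⊎ (i ∉ φ V × i ∈ φ (V ⊕ ⁅ i ⁆))

InFace : Subset n → Subset n → Subset n → Set
InFace A B X = A ⊆ X × X ⊆ B

IsSinkIn : (Subset n → Subset n) → Subset n → Subset n → Subset n → Set
IsSinkIn φ A B X = InFace A B X ×
  (∀ i → InFace A B (X ⊕ ⁅ i ⁆) → i ∉ φ X)

IsUSO : (Subset n → Subset n) → Set
IsUSO {n} φ = ∀ (A B : Subset n) → A ⊆ B →
  ∃ (λ X → IsSinkIn φ A B X) ×
  (∀ X Y → IsSinkIn φ A B X → IsSinkIn φ A B Y → X ≡ Y)

LArc : (Subset n → Subset n) → Subset n → Fin n → Fin n → Set
LArc φ V i j = i ∉ V × j ∉ V × i ≢ j × j ∈ (φ V ⊕ φ (V ∪ ⁅ i ⁆))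

Acyclic : (Fin n → Fin n → Set) → Set
Acyclic {n} R = ∀ (i : Fin n) → ¬ TransClosure R i i

HasPropertyL : (Subset n → Subset n) → Set
HasPropertyL {n} φ = ∀ (V : Subset n) → Acyclic (LArc φ V)

-- Given n-cube USOs φ₀ and φ₁ with property L and a direction d, the combed
-- (n+1)-cube orientation places φ₀ and φ₁ on the facets x₀ = 0 and x₀ = 1 and
-- directs every edge of coordinate 0 into the facet x₀ = d.  A face lying in a
-- facet has the sink of that facet's face; a face crossing coordinate 0 has its
-- sink in the facet d.  All 0-edges being parallel, no L-graph has an arc into
-- coordinate 0, and the remaining arcs form an L-graph of a facet, so property L
-- is inherited.  Since (d, φ₀, φ₁) can be read off the combed orientation, the
-- number N(n) of such orientations satisfies N(n+1) ≥ 2 N(n)², and N(0) = 1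
-- yields N(n) ≥ 2^(2^n - 1).
module Submission where

open import Defs
open import Data.Nat using (ℕ; _≤_; _^_; _∸_; zero; suc; _+_; _*_)
open import Data.Nat.Properties using (^-distribˡ-+-*; m^n>0; +-identityʳ; +-suc)
open import Data.Bool using (Bool; true; false; _xor_; not; if_then_else_)
open import Data.Bool.Properties using (xor-identityʳ; xor-same; ∨-identityʳ; not-¬; true-xor; xor-comm)
open import Data.Fin using (Fin; zero; suc)
open import Data.Fin.Properties using (2↔Bool; *↔×)
open import Data.Fin.Subset using (Subset; _∈_; _∉_; _⊆_; _∪_; ⁅_⁆; ⊥)
open import Data.Fin.Subset.Properties using (drop-there; drop-∷-⊆; s⊆s; out⊆)
open import Data.Vec using ([]; _∷_)
open import Data.Vec.Properties using (∷-injectiveˡ; ∷-injectiveʳ; zipWith-identityʳ)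
open import Data.Vec.Base using (here; there)
open import Data.Product using (Σ; _×_; _,_; proj₁; proj₂; ∃)
open import Data.Product.Function.NonDependent.Propositional using (_×-↔_)
open import Data.Sum using (_⊎_; inj₁; inj₂)
open import Data.Empty using (⊥-elim)
open import Relation.Nullary using (¬_)
open import Function using (_∘_; id; _↔_; _↣_; Injection)
open import Function.Properties.Inverse using (↔-trans; ↔⇒↣)
open import Relation.Binary.PropositionalEquality
open import Relation.Binary.Construct.Closure.Transitive using (TransClosure; [_]; _∷_)

private variable
  n : ℕ
  a b c x : Bool
  A B X Y : Subset n

⊕-identityʳ : (X : Subset n) → X ⊕ ⊥ ≡ X
⊕-identityʳ = zipWith-identityʳ xor-identityʳ

∷-⊕-⁅zero⁆ : (x : Bool) (X : Subset n) → (x ∷ X) ⊕ ⁅ zero ⁆ ≡ not x ∷ X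
∷-⊕-⁅zero⁆ x X = cong₂ _∷_ (trans (xor-comm x true) (true-xor x)) (⊕-identityʳ X)

∷-⊕-⁅suc⁆ : (x : Bool) (X : Subset n) (i : Fin n) → (x ∷ X) ⊕ ⁅ suc i ⁆ ≡ x ∷ (X ⊕ ⁅ i ⁆)
∷-⊕-⁅suc⁆ x X i = cong (_∷ _) (xor-identityʳ x)

∷-⊆-∷ : a ∷ A ⊆ b ∷ B → X ⊆ Y → a ∷ X ⊆ b ∷ Y
∷-⊆-∷ h k here with h here
... | here = here
∷-⊆-∷ h k (there p) = there (k p)

⊆-inside : A ⊆ B → a ∷ A ⊆ true ∷ B
⊆-inside h here = here
⊆-inside h (there p) = there (h p)

InFace-tail : InFace (a ∷ A) (b ∷ B) (x ∷ X) → InFace A B X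
InFace-tail (a⊆x , x⊆b) = drop-∷-⊆ a⊆x , drop-∷-⊆ x⊆b

InFace-with-tail : InFace (a ∷ A) (b ∷ B) (x ∷ X) → InFace A B Y → InFace (a ∷ A) (b ∷ B) (x ∷ Y)
InFace-with-tail (a⊆x , x⊆b) (A⊆Y , Y⊆B) = ∷-⊆-∷ a⊆x A⊆Y , ∷-⊆-∷ x⊆b Y⊆B

InFace-facet : InFace A B X → InFace (c ∷ A) (c ∷ B) (c ∷ X)
InFace-facet (A⊆X , X⊆B) = s⊆s A⊆X , s⊆s X⊆B

InFace-crossing : InFace A B X → InFace (false ∷ A) (true ∷ B) (x ∷ X)
InFace-crossing (A⊆X , X⊆B) = out⊆ A⊆X , ⊆-inside X⊆B

InFace-facet-head : InFace (c ∷ A) (c ∷ B) (x ∷ X) → x ≡ c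
InFace-facet-head {c = false} {x = false} _ = refl
InFace-facet-head {c = true}  {x = true}  _ = refl
InFace-facet-head {c = false} {x = true}  (_ , x⊆c) with () ← x⊆c here
InFace-facet-head {c = true}  {x = false} (c⊆x , _) with () ← c⊆x here

module _ {R : Fin (suc n) → Fin (suc n) → Set} {R′ : Fin n → Fin n → Set}
         (zero-source : ∀ {i} → ¬ R i zero)
         (R-suc : ∀ {i j} → R (suc i) (suc j) → R′ i j) where

  private
    ¬path-to-zero : ∀ {i} → ¬ TransClosure R i zero
    ¬path-to-zero [ r ]    = zero-source r
    ¬path-to-zero (_ ∷ rs) = ¬path-to-zero rs

    path-suc : ∀ {i j} → TransClosure R (suc i) (suc j) → TransClosure R′ i j
    path-suc [ r ] = [ R-suc r ]
    path-suc (_∷_ {y = zero}  r _)  = ⊥-elim (zero-source r)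
    path-suc (_∷_ {y = suc _} r rs) = R-suc r ∷ path-suc rs

  acyclic-zero-source : Acyclic R′ → Acyclic R
  acyclic-zero-source acyclic zero    = ¬path-to-zero
  acyclic-zero-source acyclic (suc i) = acyclic i ∘ path-suc

zero∉xor⇒≡ : ∀ x y → zero ∉ (x xor y) ∷ X → x ≡ y
zero∉xor⇒≡ false false _  = refl
zero∉xor⇒≡ true  true  _  = refl
zero∉xor⇒≡ false true  0∉ = ⊥-elim (0∉ here)
zero∉xor⇒≡ true  false 0∉ = ⊥-elim (0∉ here)

≡⇒zero∉xor : ∀ {y} → x ≡ y → zero ∉ (x xor y) ∷ X
≡⇒zero∉xor {y = y} refl rewrite xor-same y = λ ()

zero-exclusive : ∀ x d {p q : Subset n} →
  (zero ∈ (x xor d) ∷ p × zero ∉ ((x xor true) xor d) ∷ q) ⊎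
  (zero ∉ (x xor d) ∷ p × zero ∈ ((x xor true) xor d) ∷ q)
zero-exclusive false false = inj₂ ((λ ()) , here)
zero-exclusive false true  = inj₁ (here , (λ ()))
zero-exclusive true  false = inj₁ (here , (λ ()))
zero-exclusive true  true  = inj₂ ((λ ()) , here)

there-exclusive : ∀ {i : Fin n} {p q} →
  (i ∈ p × i ∉ q) ⊎ (i ∉ p × i ∈ q) →
  (suc i ∈ a ∷ p × suc i ∉ b ∷ q) ⊎ (suc i ∉ a ∷ p × suc i ∈ b ∷ q)
there-exclusive (inj₁ (i∈p , i∉q)) = inj₁ (there i∈p , i∉q ∘ drop-there)
there-exclusive (inj₂ (i∉p , i∈q)) = inj₂ (i∉p ∘ drop-there , there i∈q)

UniqueSink : (Subset n → Subset n) → Subset n → Subset n → Set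
UniqueSink φ A B = ∃ (IsSinkIn φ A B) × (∀ X Y → IsSinkIn φ A B X → IsSinkIn φ A B Y → X ≡ Y)

combed : Bool → (Bool → Subset n → Subset n) → Subset (suc n) → Subset (suc n)
combed d φ (x ∷ X) = (x xor d) ∷ φ x X

combed-injective : ∀ {d d′} {φ ψ : Bool → Subset n → Subset n} →
  combed d φ ≗ combed d′ ψ → d ≡ d′ × (∀ x → φ x ≗ ψ x)
combed-injective eq = ∷-injectiveˡ (eq (false ∷ ⊥)) , λ x X → ∷-injectiveʳ (eq (x ∷ X))

module _ (d : Bool) (φ : Bool → Subset n → Subset n) where

  private
    Φ : Subset (suc n) → Subset (suc n)
    Φ = combed d φ

  combed-isOrientation : (∀ x → IsOrientation (φ x)) → IsOrientation Φ
  combed-isOrientation o (x ∷ X) (suc i) rewrite xor-identityʳ x = there-exclusive (o x X i)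
  combed-isOrientation o (x ∷ X) zero = zero-exclusive x d

  private
    heads-cancel : ∀ x X (i : Fin n) → zero ∉ Φ (x ∷ X) ⊕ Φ ((x ∷ X) ∪ ⁅ suc i ⁆)
    heads-cancel x X i rewrite ∨-identityʳ x | xor-same (x xor d) = λ ()

    tails : ∀ x X (i j : Fin n) → suc j ∈ Φ (x ∷ X) ⊕ Φ ((x ∷ X) ∪ ⁅ suc i ⁆) → j ∈ φ x X ⊕ φ x (X ∪ ⁅ i ⁆)
    tails x X i j rewrite ∨-identityʳ x = drop-there

    no-LArc-to-zero : ∀ V {i} → ¬ LArc Φ V i zero
    no-LArc-to-zero V {zero}  (_ , _ , i≢j , _) = i≢j refl
    no-LArc-to-zero (x ∷ X) {suc i} (_ , _ , _ , 0∈) = heads-cancel x X i 0∈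

    LArc-suc : ∀ x X {i j} → LArc Φ (x ∷ X) (suc i) (suc j) → LArc (φ x) X i j
    LArc-suc x X {i} {j} (i∉ , j∉ , i≢j , j∈) =
      i∉ ∘ there , j∉ ∘ there , i≢j ∘ cong suc , tails x X i j j∈

  combed-hasPropertyL : (∀ x → HasPropertyL (φ x)) → HasPropertyL Φ
  combed-hasPropertyL l (x ∷ X) =
    acyclic-zero-source (no-LArc-to-zero (x ∷ X)) (LArc-suc x X) (l x X)

  private
    sink-tail : IsSinkIn Φ (a ∷ A) (b ∷ B) (x ∷ X) → IsSinkIn (φ x) A B X
    sink-tail {x = x} {X = X} (inF , no-out) = InFace-tail inF , λ i inF′ i∈ →
      no-out (suc i) (subst (InFace _ _) (sym (∷-⊕-⁅suc⁆ x X i)) (InFace-with-tail inF inF′)) (there i∈)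

    sink-∷ : InFace (a ∷ A) (b ∷ B) (x ∷ X) → IsSinkIn (φ x) A B X →
      (InFace (a ∷ A) (b ∷ B) (not x ∷ X) → x ≡ d) → IsSinkIn Φ (a ∷ A) (b ∷ B) (x ∷ X)
    sink-∷ {x = x} {X = X} inF (_ , no-out) flip-sink = inF , λ where
      zero    inF′ → ≡⇒zero∉xor (flip-sink (subst (InFace _ _) (∷-⊕-⁅zero⁆ x X) inF′))
      (suc i) inF′ → no-out i (InFace-tail inF′) ∘ drop-there

    crossing-sink-head : IsSinkIn Φ (false ∷ A) (true ∷ B) (x ∷ X) → x ≡ d
    crossing-sink-head {x = x} {X = X} (inF , no-out) = zero∉xor⇒≡ x d (no-out zero
      (subst (InFace _ _) (sym (∷-⊕-⁅zero⁆ x X)) (InFace-crossing (InFace-tail inF))))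

    unique-sink-∷ : ∀ c →
      (∀ {X} → InFace A B X → InFace (a ∷ A) (b ∷ B) (c ∷ X)) →
      (∀ {X} → InFace (a ∷ A) (b ∷ B) (not c ∷ X) → c ≡ d) →
      (∀ {y Y} → IsSinkIn Φ (a ∷ A) (b ∷ B) (y ∷ Y) → y ≡ c) →
      UniqueSink (φ c) A B → UniqueSink Φ (a ∷ A) (b ∷ B)
    unique-sink-∷ {A = A} {B = B} {a = a} {b = b} c lift flip-sink sink-head ((X , X-sink) , unique) =
      (c ∷ X , sink-∷ (lift (proj₁ X-sink)) X-sink flip-sink) , unique′
      where
      unique′ : ∀ X Y → IsSinkIn Φ (a ∷ A) (b ∷ B) X → IsSinkIn Φ (a ∷ A) (b ∷ B) Y → X ≡ Y
      unique′ (y ∷ Y) (z ∷ Z) Y-sink Z-sink with refl ← sink-head Y-sink | refl ← sink-head Z-sink =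
        cong (c ∷_) (unique Y Z (sink-tail Y-sink) (sink-tail Z-sink))

    unique-sink-facet : ∀ c → UniqueSink (φ c) A B → UniqueSink Φ (c ∷ A) (c ∷ B)
    unique-sink-facet c = unique-sink-∷ c InFace-facet
      (λ inF → ⊥-elim (not-¬ refl (sym (InFace-facet-head inF)))) (InFace-facet-head ∘ proj₁)

    unique-sink-crossing : UniqueSink (φ d) A B → UniqueSink Φ (false ∷ A) (true ∷ B)
    unique-sink-crossing = unique-sink-∷ d InFace-crossing (λ _ → refl) crossing-sink-head

  combed-isUSO : (∀ x → IsUSO (φ x)) → IsUSO Φ
  combed-isUSO u (false ∷ A) (false ∷ B) A⊆B = unique-sink-facet false (u false A B (drop-∷-⊆ A⊆B))
  combed-isUSO u (true  ∷ A) (true  ∷ B) A⊆B = unique-sink-facet true  (u true  A B (drop-∷-⊆ A⊆B))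
  combed-isUSO u (false ∷ A) (true  ∷ B) A⊆B = unique-sink-crossing (u d A B (drop-∷-⊆ A⊆B))
  combed-isUSO u (true  ∷ A) (false ∷ B) A⊆B with () ← A⊆B here

IsLUSO : (Subset n → Subset n) → Set
IsLUSO φ = IsOrientation φ × IsUSO φ × HasPropertyL φ

combed-isLUSO : ∀ d {φ : Bool → Subset n → Subset n} → (∀ x → IsLUSO (φ x)) → IsLUSO (combed d φ)
combed-isLUSO d φ-LUSO =
  combed-isOrientation d _ (proj₁ ∘ φ-LUSO) ,
  combed-isUSO d _ (proj₁ ∘ proj₂ ∘ φ-LUSO) ,
  combed-hasPropertyL d _ (proj₂ ∘ proj₂ ∘ φ-LUSO)

LUSOFamily : ℕ → Set → Set
LUSOFamily n I = Σ (I → Subset n → Subset n) λ f → (∀ i j → f i ≗ f j → i ≡ j) × (∀ i → IsLUSO (f i))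

reindex : {I J : Set} → J ↣ I → LUSOFamily n I → LUSOFamily n J
reindex ι (f , f-injective , f-LUSO) = f ∘ to , (λ i j → injective ∘ f-injective (to i) (to j)) , f-LUSO ∘ to
  where open Injection ι

combed-family : {I : Set} → LUSOFamily n I → LUSOFamily (suc n) (Bool × I × I)
combed-family {n} {I} (f , f-injective , f-LUSO) = F , F-injective , λ (d , _ , _) → combed-isLUSO d (f-LUSO ∘ _)
  where
  facets : I → I → Bool → Subset n → Subset n
  facets i₀ i₁ x = f (if x then i₁ else i₀)

  F : Bool × I × I → Subset (suc n) → Subset (suc n)
  F (d , i₀ , i₁) = combed d (facets i₀ i₁)

  F-injective : ∀ p q → F p ≗ F q → p ≡ q
  F-injective (d , i₀ , i₁) (_ , j₀ , j₁) F≗ with combed-injective F≗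
  ... | refl , facets≗ =
    cong₂ (λ k l → d , k , l) (f-injective i₀ j₀ (facets≗ false)) (f-injective i₁ j₁ (facets≗ true))

point-isLUSO : IsLUSO {0} (λ _ → [])
point-isLUSO = (λ _ ()) , unique-sink , λ _ ()
  where
  unique-sink : IsUSO {0} (λ _ → [])
  unique-sink [] [] _ = ([] , (id , id) , λ ()) , λ { [] [] _ _ → refl }

point-family : LUSOFamily 0 (Fin 1)
point-family = (λ _ _ → []) , (λ { zero zero _ → refl }) , λ _ → point-isLUSO

count : ℕ → ℕ
count n = 2 ^ (2 ^ n ∸ 1)

exponent-suc : ∀ n → 2 ^ suc n ∸ 1 ≡ suc ((2 ^ n ∸ 1) + (2 ^ n ∸ 1))
exponent-suc n with 2 ^ n | m^n>0 2 n
... | suc k | _ = trans (cong (λ m → k + suc m) (+-identityʳ k)) (+-suc k k)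

count-suc : ∀ n → count (suc n) ≡ 2 * (count n * count n)
count-suc n = trans (cong (2 ^_) (exponent-suc n)) (cong (2 *_) (^-distribˡ-+-* 2 e e))
  where e = 2 ^ n ∸ 1

Fin-count-suc↔ : ∀ n → Fin (count (suc n)) ↔ (Bool × Fin (count n) × Fin (count n))
Fin-count-suc↔ n rewrite count-suc n = ↔-trans *↔× (2↔Bool ×-↔ *↔×)

family : ∀ n → LUSOFamily n (Fin (count n))
family zero    = point-family
family (suc n) = reindex (↔⇒↣ (Fin-count-suc↔ n)) (combed-family (family n))

theorem2 : (n : ℕ) → 1 ≤ n →
    Σ (Fin (2 ^ (2 ^ n ∸ 1)) → Subset n → Subset n) λ f →
      (∀ a b → (∀ V → f a V ≡ f b V) → a ≡ b) ×
      (∀ a → IsOrientation (f a) × IsUSO (f a) × HasPropertyL (f a))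
-- The bound holds for n = 0 as well.
theorem2 n _ = family n
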